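{- An $I$-state is of the form $\langle S\cup\mathit{HMM}, T\rangle$ where $S$ is a set of ground \texttt{path} constraints and $T$ a propagation history. For any $(i\colon \texttt{path($[L|Ls]$,$q$,$P$,$qs$)}) \in S$ for which $\{ (i^t\colon\texttt{trans($q$,$q'$,$P^t$)}), (i^e\colon\texttt{emit($q$,$L$,$P^e$)})\} \subseteq \mathit{HMM}$, one and only one of the following will be the case. \begin{enumerate} \item \emph{Expansion has not taken place:} $({\texttt{expand}}@ i^t, i^e, i)\not\in T$. \item \emph{Expansion produced and still in the store:} $({\texttt{expand}}@ i^t, i^e, i)\in T \;\land\; \exists i' .\, (i'\colon \texttt{path($Ls$,$q'$,$P'$,$[q'|qs]$)}) \in S$, where $P'$ is the value of $P*P^t*P^e$. \item \emph{Expansion produced but pruned by stronger or equal alternative:} $({\texttt{expand}}@ i^t, i^e, i)\in T \;\land\; \not\exists i',P' .\, (i'\colon \texttt{path($Ls$,$q'$,$P'$,$[q'|qs]$)}) \in S$ $\land\; \exists P',qs',i' .\, \bigl((i'\colon \texttt{path($Ls$,$q'$,$P'$,$[q'|qs']$)}) \in S \land P' \geq P*P^t*P^e \land qs\neq qs'\bigr)$. \end{enumerate}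
   Context: Constraint Handling Rules (CHR) setting. A CHR state is (an equivalence class, up to renaming of variables and consistent renaming of indices, of) a pair $\langle S,T\rangle$ where $S$ is a finite indexed set of constraints $i{:}c$ (each index unique) and $T$ is a propagation history: a set of application records $r@i_1\ldots i_n$ (rule name and indices of the matched head constraints, in order) for propagation rules, each index referring to a constraint in $S$. A derivation step applies an application instance of a rule $r\colon H_1 \,\backslash\, H_2 \texttt{<=>} g \mid C$ (propagation rules written $H_1 \texttt{==>} g\mid C$, removing nothing) to head constraints present in the store, provided its guard $g$ evaluates to a proper substitution not binding head variables (runtime error or failure in a guard means the rule does not apply), and, for propagation rules, its application record is not already in $T$; the step removes the $H_2$ constraints, adds the (instantiated) body constraints with fresh indices, removes from $T$ every application record mentioning an index of a removed constraint, and adds the application record if the rule is a propagation rule. The built-in \texttt{is} evaluates a ground arithmetic expression and unifies with its value; \texttt{>=} compares two ground arithmetic values. The Viterbi program consists of the two rules \texttt{expand @ trans(Q,Q1,PT), emit(Q,L,PE), path([L|Ls],Q,P,PathRev) ==> P1 is P*PT*PE | path(Ls,Q1,P1,[Q1|PathRev]).} \texttt{prune @ path(Ls,Q,P1,\_) $\backslash$ path(Ls,Q,P2,\_) <=> P1 >= P2 | true.} A fixed Hidden Markov Model is encoded as a fixed indexed set $\mathit{HMM}$ of ground \texttt{trans($q_1$,$q_2$,$p$)} and \texttt{emit($q$,$L$,$p$)} constraints, containing for each pair of states $q_1,q_2$ at most one constraint \texttt{trans($q_1$,$q_2$,$\ldots$)} and for each state $q$ and emission letter $L$ at most one constraint \texttt{emit($q$,$L$,$\ldots$)};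 there is a fixed initial HMM state $q_0$ and a fixed input emission sequence $Ls_0$. The invariant is: $I(\Sigma)$ holds iff $\Sigma$ is reachable by zero or more derivation steps from the state $\langle \mathit{HMM} \cup \{(0\colon \texttt{path($Ls_0$,$q_0$,1,[$q_0$])})\}, \emptyset\rangle$; an $I$-state is a state satisfying $I$.
   Formalization: The probabilities of the trans and emit constraints and the path values P are rational numbers, with exact multiplication and comparison. -}

module Defs where

open import Data.Nat using (ℕ; _≟_)
open import Data.Rational using (ℚ; _*_; _≤_; 1ℚ)
open import Data.List using (List; []; _∷_; _++_; map)
open import Data.List.Membership.Propositional using (_∈_; _∉_)
open import Data.List.Relation.Unary.All using (All)
open import Data.List.Relation.Unary.Unique.Propositional using (Unique)
open import Data.List.Relation.Binary.Permutation.Propositional using (_↭_)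
open import Data.Product using (_×_; _,_; proj₁; proj₂; ∃-syntax)
open import Data.Sum using (_⊎_)
open import Data.Empty using (⊥)
open import Data.Unit using (⊤)
open import Relation.Nullary using (¬_; yes; no)
open import Relation.Binary.PropositionalEquality using (_≡_; _≢_)
open import Relation.Binary.Construct.Closure.ReflexiveTransitive using (Star)

-- Ground CHR constraints of the Viterbi program.
-- HMM states and emission letters (Prolog atoms) are coded as ℕ;
-- numbers (probabilities) are exact rationals ℚ.

data Constraint : Set where
  trans : ℕ → ℕ → ℚ → Constraint
  emit  : ℕ → ℕ → ℚ → Constraint
  path  : List ℕ → ℕ → ℚ → List ℕ → Constraint

IsPath : Constraint → Set
IsPath (path _ _ _ _) = ⊤
IsPath _ = ⊥

IConstraint : Set
IConstraint = ℕ × Constraint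

-- Application records; expand is the only propagation rule:  expandReci1 i2 i3
data AppRecord : Set where
  expandRec : ℕ → ℕ → ℕ → AppRecord

-- A state <S,T>: store (indexed constraints, indices unique in reachable
-- states since new ones are fresh) and propagation history.
State : Set
State = List IConstraint × List AppRecord

indices : List IConstraint → List ℕ
indices = map proj₁

removeIdx : ℕ → List IConstraint → List IConstraint
removeIdx j [] = []
removeIdx j ((i , c) ∷ s) with i ≟ j
... | yes _ = removeIdx j s
... | no  _ = (i , c) ∷ removeIdx j s

mentions : ℕ → AppRecord → Set
mentions j (expandRec a b c) = (a ≡ j) ⊎ (b ≡ j) ⊎ (c ≡ j)

removeRecs : ℕ → List AppRecord → List AppRecord
removeRecs j [] = []
removeRecs j (expandRec a b c ∷ t) with a ≟ j | b ≟ j | c ≟ j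
... | no _ | no _ | no _ = expandRec a b c ∷ removeRecs j t
... | _    | _    | _    = removeRecs j t

data Step : State → State → Set where
  -- expand @ trans(Q,Q1,PT), emit(Q,L,PE), path([L|Ls],Q,P,PathRev)
  --          ==> P1 is P*PT*PE | path(Ls,Q1,P1,[Q1|PathRev]).
  expandStep : ∀ {S T it ie ip q q′ L Ls pt pe p qs j} →
    (it , trans q q′ pt) ∈ S →
    (ie , emit q L pe) ∈ S →
    (ip , path (L ∷ Ls) q p qs) ∈ S →
    expandRec it ie ip ∉ T →
    j ∉ indices S →
    Step (S , T)
         ((j , path Ls q′ (p * pt * pe) (q′ ∷ qs)) ∷ S , expandRec it ie ip ∷ T)
  -- prune @ path(Ls,Q,P1,_) \ path(Ls,Q,P2,_) <=> P1 >= P2 | true.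
  pruneStep : ∀ {S T i j Ls q p₁ p₂ qs₁ qs₂} →
    i ≢ j →
    (i , path Ls q p₁ qs₁) ∈ S →
    (j , path Ls q p₂ qs₂) ∈ S →
    p₂ ≤ p₁ →
    Step (S , T) (removeIdx j S , removeRecs j T)

Reachable : State → State → Set
Reachable = Star Step

-- The fixed HMM: an indexed set of ground trans/emit constraints with
-- unique indices, index 0 unused (it is the initial path's index),
-- at most one trans per state pair and one emit per (state,letter).

IsTransOrEmit : Constraint → Set
IsTransOrEmit (trans _ _ _) = ⊤
IsTransOrEmit (emit _ _ _) = ⊤
IsTransOrEmit (path _ _ _ _) = ⊥

record WellFormedHMM (hmm : List IConstraint) : Set where
  field
    uniqueIdx : Unique (indices hmm)
    zeroFree  : 0 ∉ indices hmm
    onlyTE    : All (λ x → IsTransOrEmit (proj₂ x)) hmm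
    transFun  : ∀ {i j q₁ q₂ p p′} →
      (i , trans q₁ q₂ p) ∈ hmm → (j , trans q₁ q₂ p′) ∈ hmm → i ≡ j × p ≡ p′
    emitFun   : ∀ {i j q L p p′} →
      (i , emit q L p) ∈ hmm → (j , emit q L p′) ∈ hmm → i ≡ j × p ≡ p′

initialState : List IConstraint → ℕ → List ℕ → State
initialState hmm q₀ Ls₀ = ((0 , path Ls₀ q₀ 1ℚ (q₀ ∷ [])) ∷ hmm) , []

Inv : List IConstraint → ℕ → List ℕ → State → Set
Inv hmm q₀ Ls₀ Σ = Reachable (initialState hmm q₀ Ls₀) Σ

ExactlyOne : Set → Set → Set → Set
ExactlyOne A B C = (A ⊎ B ⊎ C) × ¬ (A × B) × ¬ (A × C) × ¬ (B × C)

module Submission where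

-- The proof is an invariant argument.  We define when a list Ps of path
-- constraints is `Coherent` with a history T, show that the initial state is
-- Ps ++ hmm for a coherent Ps, that expand and prune steps preserve this
-- shape, and read the trichotomy off coherence.  Coherence says: indices
-- determine constraints; a PathRev starts with the path's state and
-- identifies its path; whenever a path and one of its descendants are both
-- live, the expansion of the path towards that descendant is recorded; and
-- every record belongs to a live path whose child is live or was pruned by a
-- path at least as probable.  The descendant clause is what makes the
-- invariant inductive: it prevents an expansion from re-creating a PathRev,
-- which could otherwise falsify the "no child is live" part of case 3.

open import Defs
open import Data.Nat using (ℕ; _≟_)
open import Data.Rational using (ℚ; _*_; _≤_; 1ℚ)
open import Data.Rational.Properties using (≤-refl; ≤-trans)
open import Data.List using (List; []; _∷_; _++_; filter)
open import Data.List.Properties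
  using (++-assoc; ++-identityˡ-unique; ∷-injectiveʳ; filter-accept; filter-reject; filter-++; filter-all)
open import Data.List.Membership.Propositional using (_∈_; _∉_)
open import Data.List.Membership.Propositional.Properties
  using (∈-map⁺; ∈-map⁻; ∈-++⁺ˡ; ∈-++⁺ʳ; ∈-++⁻; ∈-filter⁺; ∈-filter⁻)
open import Data.List.Relation.Unary.Any using (here; there; any?)
open import Data.List.Relation.Unary.All using (All)
import Data.List.Relation.Unary.All as All
open import Data.List.Relation.Unary.AllPairs using (_∷_)
open import Data.List.Relation.Unary.Unique.Propositional using (Unique)
open import Data.List.Relation.Binary.Permutation.Propositional using (_↭_; ↭-refl)
open import Data.Product using (_×_; _,_; proj₁; proj₂; ∃-syntax)
open import Data.Sum using (_⊎_; inj₁; inj₂)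
open import Data.Empty using (⊥-elim)
open import Function using (_∘_)
open import Relation.Nullary using (¬_; yes; no; Dec; ¬?; _⊎-dec_; _×-dec_)
open import Relation.Nullary.Decidable using (map′)
open import Relation.Binary.Definitions using (DecidableEquality)
open import Relation.Binary.PropositionalEquality
  using (_≡_; _≢_; refl; sym; cong; cong₂; subst; module ≡-Reasoning)
  renaming (trans to ≡-trans)
open import Relation.Binary.Construct.Closure.ReflexiveTransitive using (ε; _◅_)

private variable
  S A : List IConstraint
  T : List AppRecord
  i j k a it ie it′ ie′ i′ q q′ x L L′ : ℕ
  Ls Ls′ xs qs qs′ : List ℕ
  p p′ p″ p₁ p₂ pt pe pt′ pe′ v : ℚ
  c : Constraint

-- A list is never equal to a proper extension of itself; PathRevs of
-- descendants are proper extensions.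
extension-≢ : (zs : List ℕ) (x : ℕ) (xs : List ℕ) → xs ≢ zs ++ x ∷ xs
extension-≢ zs x xs eq
  with ++-identityˡ-unique (zs ++ x ∷ []) (≡-trans eq (sym (++-assoc zs (x ∷ []) xs)))
extension-≢ []      x xs eq | ()
extension-≢ (_ ∷ _) x xs eq | ()

pathRevOf : IConstraint → List ℕ
pathRevOf (_ , path _ _ _ ys) = ys
pathRevOf _                   = []

_≟ʳ_ : DecidableEquality AppRecord
expandRec a b c ≟ʳ expandRec a′ b′ c′ =
  map′ (λ { (refl , refl , refl) → refl }) (λ { refl → refl , refl , refl })
       (a ≟ a′ ×-dec b ≟ b′ ×-dec c ≟ c′)

mentions? : ∀ j r → Dec (mentions j r)
mentions? j (expandRec a b c) = a ≟ j ⊎-dec b ≟ j ⊎-dec c ≟ j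

keepIdx? : ∀ j (y : IConstraint) → Dec (proj₁ y ≢ j)
keepIdx? j y = ¬? (proj₁ y ≟ j)

removeIdx-filter : ∀ j S → removeIdx j S ≡ filter (keepIdx? j) S
removeIdx-filter j [] = refl
removeIdx-filter j ((i , c) ∷ S) with i ≟ j
... | yes i≡j = ≡-trans (removeIdx-filter j S)
                  (sym (filter-reject (keepIdx? j) {x = i , c} {xs = S} (λ i≢j → i≢j i≡j)))
... | no i≢j  = ≡-trans (cong ((i , c) ∷_) (removeIdx-filter j S))
                  (sym (filter-accept (keepIdx? j) {x = i , c} {xs = S} i≢j))

keepRec? : ∀ j r → Dec (¬ mentions j r)
keepRec? j r = ¬? (mentions? j r)

filter-drops : ∀ j T {r} → mentions j r → filter (keepRec? j) (r ∷ T) ≡ filter (keepRec? j) T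
filter-drops j T {r} m = filter-reject (keepRec? j) {x = r} {xs = T} (λ nm → nm m)

removeRecs-filter : ∀ j T → removeRecs j T ≡ filter (keepRec? j) T
removeRecs-filter j [] = refl
removeRecs-filter j (expandRec a b c ∷ T) with a ≟ j | b ≟ j | c ≟ j
... | no a≢j | no b≢j | no c≢j =
  ≡-trans (cong (expandRec a b c ∷_) (removeRecs-filter j T))
    (sym (filter-accept (keepRec? j) {x = expandRec a b c} {xs = T}
      λ { (inj₁ e) → a≢j e ; (inj₂ (inj₁ e)) → b≢j e ; (inj₂ (inj₂ e)) → c≢j e }))
... | yes e | _ | _ =
  ≡-trans (removeRecs-filter j T) (sym (filter-drops j T {expandRec a b c} (inj₁ e)))
... | no _ | yes e | _ =
  ≡-trans (removeRecs-filter j T) (sym (filter-drops j T {expandRec a b c} (inj₂ (inj₁ e))))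
... | no _ | no _ | yes e =
  ≡-trans (removeRecs-filter j T) (sym (filter-drops j T {expandRec a b c} (inj₂ (inj₂ e))))

∈-removeIdx⁻ : ∀ {y} → y ∈ removeIdx j S → y ∈ S × proj₁ y ≢ j
∈-removeIdx⁻ {j = j} {S = S} m = ∈-filter⁻ (keepIdx? j) (subst (_ ∈_) (removeIdx-filter j S) m)

∈-removeIdx⁺ : ∀ {y} → y ∈ S → proj₁ y ≢ j → y ∈ removeIdx j S
∈-removeIdx⁺ {S = S} {j = j} m ne = subst (_ ∈_) (sym (removeIdx-filter j S)) (∈-filter⁺ (keepIdx? j) m ne)

∈-removeRecs⁻ : ∀ {r} → r ∈ removeRecs j T → r ∈ T × ¬ mentions j r
∈-removeRecs⁻ {j = j} {T = T} m = ∈-filter⁻ (keepRec? j) (subst (_ ∈_) (removeRecs-filter j T) m)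

∈-removeRecs⁺ : ∀ {r} → r ∈ T → ¬ mentions j r → r ∈ removeRecs j T
∈-removeRecs⁺ {T = T} {j = j} m nm = subst (_ ∈_) (sym (removeRecs-filter j T)) (∈-filter⁺ (keepRec? j) m nm)

removeIdx-++ : ∀ j A B → j ∉ indices B → removeIdx j (A ++ B) ≡ removeIdx j A ++ B
removeIdx-++ j A B j∉B = begin
  removeIdx j (A ++ B)                      ≡⟨ removeIdx-filter j (A ++ B) ⟩
  filter (keepIdx? j) (A ++ B)              ≡⟨ filter-++ (keepIdx? j) A B ⟩
  filter (keepIdx? j) A ++ filter (keepIdx? j) B
    ≡⟨ cong₂ _++_ (sym (removeIdx-filter j A)) (filter-all (keepIdx? j) kept) ⟩
  removeIdx j A ++ B                        ∎
  where
    open ≡-Reasoning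
    kept : All (λ y → proj₁ y ≢ j) B
    kept = All.tabulate λ m e → j∉B (subst (_∈ indices B) e (∈-map⁺ proj₁ m))

Functional : List IConstraint → Set
Functional S = ∀ {i c c′} → (i , c) ∈ S → (i , c′) ∈ S → c ≡ c′

unique⇒functional : Unique (indices S) → Functional S
unique⇒functional (_ ∷ _)     (here refl) (here refl) = refl
unique⇒functional (fresh ∷ _) (here refl) (there m)   = ⊥-elim (All.lookup fresh (∈-map⁺ proj₁ m) refl)
unique⇒functional (fresh ∷ _) (there m)   (here refl) = ⊥-elim (All.lookup fresh (∈-map⁺ proj₁ m) refl)
unique⇒functional (_ ∷ u)     (there m)   (there m′)  = unique⇒functional u m m′

fresh-functional : Functional S → j ∉ indices S → Functional ((j , c) ∷ S)
fresh-functional fun fresh (here refl) (here refl) = refl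
fresh-functional fun fresh (here refl) (there m)   = ⊥-elim (fresh (∈-map⁺ proj₁ m))
fresh-functional fun fresh (there m)   (here refl) = ⊥-elim (fresh (∈-map⁺ proj₁ m))
fresh-functional fun fresh (there m)   (there m′)  = fun m m′

module Invariant (hmm : List IConstraint) (wf : WellFormedHMM hmm) where
  open WellFormedHMM wf

  ChildLive : List IConstraint → List ℕ → ℕ → ℚ → List ℕ → Set
  ChildLive Ps Ls q′ v qs = ∃[ i′ ] ((i′ , path Ls q′ v (q′ ∷ qs)) ∈ Ps)

  ChildGone : List IConstraint → List ℕ → ℕ → List ℕ → Set
  ChildGone Ps Ls q′ qs = ¬ (∃[ i′ ] ∃[ P′ ] ((i′ , path Ls q′ P′ (q′ ∷ qs)) ∈ Ps))

  ChildAccounted : List IConstraint → List ℕ → ℕ → ℚ → List ℕ → Set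
  ChildAccounted Ps Ls q′ v qs =
    ChildLive Ps Ls q′ v qs ⊎
    (ChildGone Ps Ls q′ qs ×
     ∃[ P′ ] ∃[ qs′ ] ∃[ i′ ] ((i′ , path Ls q′ P′ (q′ ∷ qs′)) ∈ Ps × v ≤ P′))

  data Justified (Ps : List IConstraint) (it ie i : ℕ) : Set where
    justified : ∀ {q q′ L Ls pt pe p qs} →
      (it , trans q q′ pt) ∈ hmm → (ie , emit q L pe) ∈ hmm →
      (i , path (L ∷ Ls) q p qs) ∈ Ps → ChildAccounted Ps Ls q′ (p * pt * pe) qs →
      Justified Ps it ie i

  record Coherent (Ps : List IConstraint) (T : List AppRecord) : Set where
    field
      onlyPaths     : All (λ y → IsPath (proj₂ y)) Ps
      indexFun      : Functional (Ps ++ hmm)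
      startsAtState : ∀ {i Ls q p xs} → (i , path Ls q p xs) ∈ Ps → ∃[ ys ] (xs ≡ q ∷ ys)
      pathRevKey    : ∀ {i k Ls q p Ls′ q′ p′ xs} →
        (i , path Ls q p xs) ∈ Ps → (k , path Ls′ q′ p′ xs) ∈ Ps → i ≡ k
      descendantsRecorded : ∀ {i k L Ls q p xs Ls′ q′ p′ zs x it ie pt pe} →
        (i , path (L ∷ Ls) q p xs) ∈ Ps → (k , path Ls′ q′ p′ (zs ++ x ∷ xs)) ∈ Ps →
        (it , trans q x pt) ∈ hmm → (ie , emit q L pe) ∈ hmm → expandRec it ie i ∈ T
      recordsJustified : ∀ {it ie i} → expandRec it ie i ∈ T → Justified Ps it ie i
  open Coherent

  -- hmm contains no paths, so trans/emit constraints of Ps ++ hmm lie in hmm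
  -- and path constraints lie in Ps.
  inHmm : All (λ y → IsPath (proj₂ y)) A → (i , c) ∈ A ++ hmm → ¬ IsPath c → (i , c) ∈ hmm
  inHmm {A = A} onlyP m notPath with ∈-++⁻ A m
  ... | inj₁ m′ = ⊥-elim (notPath (All.lookup onlyP m′))
  ... | inj₂ m′ = m′

  inPaths : (i , path Ls q p xs) ∈ A ++ hmm → (i , path Ls q p xs) ∈ A
  inPaths {A = A} m with ∈-++⁻ A m
  ... | inj₁ m′ = m′
  ... | inj₂ m′ = ⊥-elim (All.lookup onlyTE m′)

  pathIdx∉hmm : Coherent A T → (j , path Ls q p xs) ∈ A → (k , c) ∈ hmm → k ≢ j
  pathIdx∉hmm {A = A} coh mj mk refl with indexFun coh (∈-++⁺ʳ A mk) (∈-++⁺ˡ mj)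
  ... | refl = All.lookup onlyTE mk

  -- Paths with equal PathRev expanded towards the same state carry the same
  -- record, since hmm has one trans per state pair and one emit per letter.
  sameRecord : Coherent A T →
    (i , path (L ∷ Ls) q p xs) ∈ A → (i′ , path (L′ ∷ Ls′) q′ p′ xs) ∈ A →
    (it , trans q x pt) ∈ hmm → (ie , emit q L pe) ∈ hmm →
    (it′ , trans q′ x pt′) ∈ hmm → (ie′ , emit q′ L′ pe′) ∈ hmm →
    expandRec it ie i ≡ expandRec it′ ie′ i′
  sameRecord coh mi mi′ mt me mt′ me′ with pathRevKey coh mi mi′
  ... | refl with indexFun coh (∈-++⁺ˡ mi) (∈-++⁺ˡ mi′)
  ...   | refl with transFun mt mt′ | emitFun me me′
  ...     | refl , _ | refl , _ = refl

  -- No live path has the child's PathRev: it would be a descendant of ip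
  -- towards q′, so the expansion would already be recorded.
  expand-pathRevKey : Coherent A T →
    (it , trans q q′ pt) ∈ hmm → (ie , emit q L pe) ∈ hmm →
    (i , path (L ∷ Ls) q p qs) ∈ A → expandRec it ie i ∉ T →
    ∀ {k₁ k₂ Ls₁ Ls₂ q₁ q₂ p₁ p₂ ys} →
    (k₁ , path Ls₁ q₁ p₁ ys) ∈ (j , path Ls q′ (p * pt * pe) (q′ ∷ qs)) ∷ A →
    (k₂ , path Ls₂ q₂ p₂ ys) ∈ (j , path Ls q′ (p * pt * pe) (q′ ∷ qs)) ∷ A → k₁ ≡ k₂
  expand-pathRevKey coh mt me mp nr (here refl) (here refl) = refl
  expand-pathRevKey coh mt me mp nr (here refl) (there m)   =
    ⊥-elim (nr (descendantsRecorded coh {zs = []} mp m mt me))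
  expand-pathRevKey coh mt me mp nr (there m)   (here refl) =
    ⊥-elim (nr (descendantsRecorded coh {zs = []} mp m mt me))
  expand-pathRevKey coh mt me mp nr (there m)   (there m′)  = pathRevKey coh m m′

  -- The child descends only from ip (the new record) and ip's ancestors
  -- (recorded already); it has no live descendant, since that would be a
  -- descendant of ip towards q′ and the expansion would be recorded.
  expand-descendantsRecorded : Coherent A T →
    (it , trans q q′ pt) ∈ hmm → (ie , emit q L pe) ∈ hmm →
    (i , path (L ∷ Ls) q p qs) ∈ A → expandRec it ie i ∉ T →
    ∀ {i₁ k L₁ Ls₁ q₁ p₁ xs Ls′ q″ p′ zs x it₁ ie₁ pt₁ pe₁} →
    (i₁ , path (L₁ ∷ Ls₁) q₁ p₁ xs) ∈ (j , path Ls q′ (p * pt * pe) (q′ ∷ qs)) ∷ A →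
    (k , path Ls′ q″ p′ (zs ++ x ∷ xs)) ∈ (j , path Ls q′ (p * pt * pe) (q′ ∷ qs)) ∷ A →
    (it₁ , trans q₁ x pt₁) ∈ hmm → (ie₁ , emit q₁ L₁ pe₁) ∈ hmm →
    expandRec it₁ ie₁ i₁ ∈ expandRec it ie i ∷ T
  expand-descendantsRecorded {q′ = q′} {qs = qs} coh mt me mp nr {zs = zs} {x = x}
    (here eqᵢ) (here eqₖ) _ _ =
    ⊥-elim (extension-≢ zs x (q′ ∷ qs)
      (≡-trans (sym (cong pathRevOf eqₖ)) (cong (λ ys → zs ++ x ∷ ys) (cong pathRevOf eqᵢ))))
  expand-descendantsRecorded {A = A} {q′ = q′} {qs = qs} coh mt me mp nr {zs = zs} {x = x}
    (here refl) (there mk) _ _ =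
    ⊥-elim (nr (descendantsRecorded coh mp
      (subst (λ ys → (_ , path _ _ _ ys) ∈ A) (sym (++-assoc zs (x ∷ []) (q′ ∷ qs))) mk) mt me))
  expand-descendantsRecorded coh mt me mp nr {zs = []} (there mi) (here refl) mt₁ me₁ =
    here (sameRecord coh mi mp mt₁ me₁ mt me)
  expand-descendantsRecorded {A = A} coh mt me mp nr {zs = z ∷ zs} (there mi) (here eq) mt₁ me₁ =
    there (descendantsRecorded coh mi
      (subst (λ ys → (_ , path _ _ _ ys) ∈ A) (sym (∷-injectiveʳ (cong pathRevOf eq))) mp) mt₁ me₁)
  expand-descendantsRecorded coh mt me mp nr (there mi) (there mk) mt₁ me₁ =
    there (descendantsRecorded coh mi mk mt₁ me₁)

  -- Earlier records stay accounted for: a live child stays live, and the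
  -- new child is never a missing child of an earlier record (that record
  -- would be the current, unrecorded one).
  expand-accounted : Coherent A T →
    (it , trans q q′ pt) ∈ hmm → (ie , emit q L pe) ∈ hmm →
    (i , path (L ∷ Ls) q p qs) ∈ A → expandRec it ie i ∉ T →
    ∀ {it₁ ie₁ i₁ q₁ q₂ L₁ Ls₁ pt₁ pe₁ p₁ qs₁ v} →
    expandRec it₁ ie₁ i₁ ∈ T → (it₁ , trans q₁ q₂ pt₁) ∈ hmm → (ie₁ , emit q₁ L₁ pe₁) ∈ hmm →
    (i₁ , path (L₁ ∷ Ls₁) q₁ p₁ qs₁) ∈ A → ChildAccounted A Ls₁ q₂ v qs₁ →
    ChildAccounted ((j , path Ls q′ (p * pt * pe) (q′ ∷ qs)) ∷ A) Ls₁ q₂ v qs₁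
  expand-accounted coh mt me mp nr r mt₁ me₁ mi (inj₁ (b , mb)) = inj₁ (b , there mb)
  expand-accounted {A = A} {T = T} {q′ = q′} {pt = pt} {pe = pe} {Ls = Ls} {p = p} {qs = qs} {j = j}
    coh mt me mp nr {q₂ = q₂} {Ls₁ = Ls₁} {qs₁ = qs₁} r mt₁ me₁ mi (inj₂ (none , P′ , qs′ , b , mb , v≤P′)) =
    inj₂ (none′ , P′ , qs′ , b , there mb , v≤P′)
    where
      none′ : ChildGone ((j , path Ls q′ (p * pt * pe) (q′ ∷ qs)) ∷ A) Ls₁ q₂ qs₁
      none′ (_ , _ , here refl) = nr (subst (_∈ T) (sameRecord coh mi mp mt₁ me₁ mt me) r)
      none′ (i′ , P″ , there m) = none (i′ , P″ , m)

  expand-coherent : Coherent A T →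
    (it , trans q q′ pt) ∈ hmm → (ie , emit q L pe) ∈ hmm →
    (i , path (L ∷ Ls) q p qs) ∈ A → expandRec it ie i ∉ T → j ∉ indices (A ++ hmm) →
    Coherent ((j , path Ls q′ (p * pt * pe) (q′ ∷ qs)) ∷ A) (expandRec it ie i ∷ T)
  expand-coherent {qs = qs} coh mt me mp nr fresh = record
    { onlyPaths           = _ All.∷ onlyPaths coh
    ; indexFun            = fresh-functional (indexFun coh) fresh
    ; startsAtState       = λ { (here refl) → qs , refl ; (there m) → startsAtState coh m }
    ; pathRevKey          = expand-pathRevKey coh mt me mp nr
    ; descendantsRecorded = expand-descendantsRecorded coh mt me mp nr
    ; recordsJustified    = justifiedAfter }
    where
      justifiedAfter : ∀ {it₁ ie₁ i₁} → expandRec it₁ ie₁ i₁ ∈ _ ∷ _ → Justified (_ ∷ _) it₁ ie₁ i₁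
      justifiedAfter (here refl) = justified mt me (there mp) (inj₁ (_ , here refl))
      justifiedAfter (there r) with recordsJustified coh r
      ... | justified mt₁ me₁ mi ch = justified mt₁ me₁ (there mi) (expand-accounted coh mt me mp nr r mt₁ me₁ mi ch)

  pruned-pathRev-gone : Coherent A T → (j , path Ls q p (q′ ∷ xs)) ∈ A →
    ChildGone (removeIdx j A) Ls′ q′ xs
  pruned-pathRev-gone coh mj (k , P′ , mk) =
    let (mk₀ , k≢j) = ∈-removeIdx⁻ mk in k≢j (pathRevKey coh mk₀ mj)

  pruner-dominates : Coherent A T → a ≢ j →
    (a , path Ls q p₁ qs) ∈ A → (j , path Ls q p₂ qs′) ∈ A → p₂ ≤ p₁ →
    (j , path Ls′ q′ p″ xs) ∈ A → v ≤ p″ →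
    ∃[ P′ ] ∃[ ys ] ∃[ i′ ] ((i′ , path Ls′ q′ P′ (q′ ∷ ys)) ∈ removeIdx j A × v ≤ P′)
  pruner-dominates {p₁ = p₁} coh a≢j ma mj p₂≤p₁ mc v≤p″ with indexFun coh (∈-++⁺ˡ mc) (∈-++⁺ˡ mj)
  ... | refl with startsAtState coh ma
  ...   | ys , refl = p₁ , ys , _ , ∈-removeIdx⁺ ma a≢j , ≤-trans v≤p″ p₂≤p₁

  -- Pruning keeps every child accounted for: a pruned live child leaves
  -- case 3 with the pruner as witness, and a pruned witness is replaced by it.
  prune-accounted : Coherent A T → a ≢ j →
    (a , path Ls q p₁ qs) ∈ A → (j , path Ls q p₂ qs′) ∈ A → p₂ ≤ p₁ →
    ChildAccounted A Ls′ q′ v xs → ChildAccounted (removeIdx j A) Ls′ q′ v xs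
  prune-accounted {j = j} coh a≢j ma mj le (inj₁ (b , mb)) with b ≟ j
  ... | no b≢j  = inj₁ (b , ∈-removeIdx⁺ mb b≢j)
  ... | yes refl = inj₂ (pruned-pathRev-gone coh mb , pruner-dominates coh a≢j ma mj le mb ≤-refl)
  prune-accounted {A = A} {j = j} {Ls′ = Ls′} {q′ = q′} {v = v} {xs = xs} coh a≢j ma mj le
    (inj₂ (none , P′ , qs₁ , b , mb , v≤P′)) =
    inj₂ (noneAfter , dominated (b ≟ j))
    where
      noneAfter : ChildGone (removeIdx j A) Ls′ q′ xs
      noneAfter (k , P″ , mk) = none (k , P″ , proj₁ (∈-removeIdx⁻ mk))
      dominated : Dec (b ≡ j) →
        ∃[ P″ ] ∃[ ys ] ∃[ i′ ] ((i′ , path Ls′ q′ P″ (q′ ∷ ys)) ∈ removeIdx j A × v ≤ P″)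
      dominated (no b≢j)  = P′ , qs₁ , b , ∈-removeIdx⁺ mb b≢j , v≤P′
      dominated (yes refl) = pruner-dominates coh a≢j ma mj le mb v≤P′

  -- A prune step keeps coherence: removal only shrinks the live paths, and a
  -- record kept by the descendant clause mentions only live indices and
  -- indices of hmm, none of which is j.
  prune-coherent : Coherent A T → a ≢ j →
    (a , path Ls q p₁ qs) ∈ A → (j , path Ls q p₂ qs′) ∈ A → p₂ ≤ p₁ →
    Coherent (removeIdx j A) (removeRecs j T)
  prune-coherent {A = A} {T = T} {j = j} coh a≢j ma mj le = record
    { onlyPaths           = All.tabulate (All.lookup (onlyPaths coh) ∘ kept)
    ; indexFun            = λ m m′ → indexFun coh (keptStore m) (keptStore m′)
    ; startsAtState       = startsAtState coh ∘ kept
    ; pathRevKey          = λ m m′ → pathRevKey coh (kept m) (kept m′)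
    ; descendantsRecorded = λ mi mk mt me →
        ∈-removeRecs⁺ (descendantsRecorded coh (kept mi) (kept mk) mt me)
          (unmentioned (pathIdx∉hmm coh mj mt) (pathIdx∉hmm coh mj me) (proj₂ (∈-removeIdx⁻ {S = A} mi)))
    ; recordsJustified    = justifiedAfter }
    where
      kept : ∀ {y} → y ∈ removeIdx j A → y ∈ A
      kept = proj₁ ∘ ∈-removeIdx⁻
      keptStore : ∀ {y} → y ∈ removeIdx j A ++ hmm → y ∈ A ++ hmm
      keptStore m with ∈-++⁻ (removeIdx j A) m
      ... | inj₁ m′ = ∈-++⁺ˡ (kept m′)
      ... | inj₂ m′ = ∈-++⁺ʳ A m′
      unmentioned : it ≢ j → ie ≢ j → i ≢ j → ¬ mentions j (expandRec it ie i)
      unmentioned it≢j _ _ (inj₁ e)        = it≢j e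
      unmentioned _ ie≢j _ (inj₂ (inj₁ e)) = ie≢j e
      unmentioned _ _ i≢j  (inj₂ (inj₂ e)) = i≢j e
      justifiedAfter : ∀ {it ie i} → expandRec it ie i ∈ removeRecs j T → Justified (removeIdx j A) it ie i
      justifiedAfter r with ∈-removeRecs⁻ r
      ... | r₀ , nm with recordsJustified coh r₀
      ...   | justified mt me mi ch =
              justified mt me (∈-removeIdx⁺ mi (nm ∘ inj₂ ∘ inj₂)) (prune-accounted coh a≢j ma mj le ch)

  CoherentState : State → Set
  CoherentState (St , T) = ∃[ Ps ] (St ≡ Ps ++ hmm × Coherent Ps T)

  -- The initial path has index 0, unused by hmm, and PathRev [q₀], which
  -- extends no other PathRev.
  initial-coherent : ∀ q₀ Ls₀ → CoherentState (initialState hmm q₀ Ls₀)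
  initial-coherent q₀ Ls₀ = _ , refl , record
    { onlyPaths           = _ All.∷ All.[]
    ; indexFun            = fresh-functional (unique⇒functional uniqueIdx) zeroFree
    ; startsAtState       = λ { (here refl) → [] , refl ; (there ()) }
    ; pathRevKey          = λ { (here refl) (here refl) → refl ; (there ()) _ ; _ (there ()) }
    ; descendantsRecorded = noDescendant
    ; recordsJustified    = λ () }
    where
      noDescendant : ∀ {i k L Ls q p xs Ls′ q′ p′ zs x it ie pt pe} →
        (i , path (L ∷ Ls) q p xs) ∈ (0 , path Ls₀ q₀ 1ℚ (q₀ ∷ [])) ∷ [] →
        (k , path Ls′ q′ p′ (zs ++ x ∷ xs)) ∈ (0 , path Ls₀ q₀ 1ℚ (q₀ ∷ [])) ∷ [] →
        (it , trans q x pt) ∈ hmm → (ie , emit q L pe) ∈ hmm → expandRec it ie i ∈ []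
      noDescendant {zs = zs} {x = x} (here refl) (here eq) _ _ =
        ⊥-elim (extension-≢ zs x (q₀ ∷ []) (sym (cong pathRevOf eq)))

  -- Both rules preserve the shape; for prune, j is a live path, so not in hmm.
  step-coherent : ∀ {Σ Σ′} → Step Σ Σ′ → CoherentState Σ → CoherentState Σ′
  step-coherent (expandStep mt me mp nr fresh) (Ps , refl , coh) =
    _ , refl , expand-coherent coh (inHmm (onlyPaths coh) mt λ ()) (inHmm (onlyPaths coh) me λ ())
                 (inPaths mp) nr fresh
  step-coherent (pruneStep {j = j} a≢j ma mj le) (Ps , refl , coh) =
    _ , removeIdx-++ j Ps hmm j∉hmm , prune-coherent coh a≢j (inPaths ma) (inPaths mj) le
    where
      j∉hmm : j ∉ indices hmm
      j∉hmm m with ∈-map⁻ proj₁ m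
      ... | _ , my , j≡ = pathIdx∉hmm coh (inPaths mj) my (sym j≡)

  reachable-coherent : ∀ {Σ Σ′} → Reachable Σ Σ′ → CoherentState Σ → CoherentState Σ′
  reachable-coherent ε       s = s
  reachable-coherent (t ◅ ts) s = reachable-coherent ts (step-coherent t s)

  ChildOutdone : List IConstraint → List ℕ → ℕ → ℚ → List ℕ → Set
  ChildOutdone Ps Ls q′ v qs =
    ∃[ P′ ] ∃[ qs′ ] ∃[ i′ ] ((i′ , path Ls q′ P′ (q′ ∷ qs′)) ∈ Ps × v ≤ P′ × qs ≢ qs′)

  -- Every expansion of a live path of a coherent state is in exactly one of
  -- the three situations; a record yields case 2 or 3 via its justification,
  -- whose trans, emit and path coincide with the given ones by functionality.
  trichotomy : Coherent A T →
    (i , path (L ∷ Ls) q p qs) ∈ A → (it , trans q q′ pt) ∈ hmm → (ie , emit q L pe) ∈ hmm →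
    ExactlyOne
      (expandRec it ie i ∉ T)
      (expandRec it ie i ∈ T × ChildLive A Ls q′ (p * pt * pe) qs)
      (expandRec it ie i ∈ T × ChildGone A Ls q′ qs × ChildOutdone A Ls q′ (p * pt * pe) qs)
  trichotomy {A = A} {T = T} {i = i} {Ls = Ls} {p = p} {qs = qs} {it = it} {q′ = q′} {pt = pt}
    {ie = ie} {pe = pe} coh mi mt me =
    cases (any? (expandRec it ie i ≟ʳ_) T) ,
    (λ (nr , r , _) → nr r) , (λ (nr , r , _) → nr r) ,
    (λ ((_ , live) , (_ , gone , _)) → gone (proj₁ live , _ , proj₂ live))
    where
      hmmFun : Functional hmm
      hmmFun = unique⇒functional uniqueIdx
      cases : Dec (expandRec it ie i ∈ T) →
        expandRec it ie i ∉ T ⊎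
        (expandRec it ie i ∈ T × ChildLive A Ls q′ (p * pt * pe) qs) ⊎
        (expandRec it ie i ∈ T × ChildGone A Ls q′ qs × ChildOutdone A Ls q′ (p * pt * pe) qs)
      cases (no nr) = inj₁ nr
      cases (yes r) with recordsJustified coh r
      ... | justified mt′ me′ mi′ ch
        with refl ← indexFun coh (∈-++⁺ˡ mi) (∈-++⁺ˡ mi′)
           | refl ← hmmFun mt mt′ | refl ← hmmFun me me′
        with ch
      ... | inj₁ live = inj₂ (inj₁ (r , live))
      ... | inj₂ (gone , P′ , qs′ , b , mb , le) =
              inj₂ (inj₂ (r , gone , P′ , qs′ , b , mb , le , λ { refl → gone (b , P′ , mb) }))

open Invariant using (Coherent; initial-coherent; reachable-coherent; trichotomy)

proposition11 : (hmm : List IConstraint) → WellFormedHMM hmm →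
    (q₀ : ℕ) (Ls₀ : List ℕ) (St : List IConstraint) (T : List AppRecord) →
    Inv hmm q₀ Ls₀ (St , T) →
    ∃[ S ] (All (λ x → IsPath (proj₂ x)) S × St ↭ S ++ hmm ×
      (∀ {i L Ls q P qs it ie q′ Pt Pe} →
        (i , path (L ∷ Ls) q P qs) ∈ S →
        (it , trans q q′ Pt) ∈ hmm →
        (ie , emit q L Pe) ∈ hmm →
        ExactlyOne
          (expandRec it ie i ∉ T)
          (expandRec it ie i ∈ T ×
            ∃[ i′ ] ((i′ , path Ls q′ (P * Pt * Pe) (q′ ∷ qs)) ∈ S))
          (expandRec it ie i ∈ T ×
            ¬ (∃[ i′ ] ∃[ P′ ] ((i′ , path Ls q′ P′ (q′ ∷ qs)) ∈ S)) ×
            ∃[ P′ ] ∃[ qs′ ] ∃[ i′ ]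
              ((i′ , path Ls q′ P′ (q′ ∷ qs′)) ∈ S ×
               P * Pt * Pe ≤ P′ × qs ≢ qs′))))
proposition11 hmm wf q₀ Ls₀ St T inv
  with Ps , refl , coh ← reachable-coherent hmm wf inv (initial-coherent hmm wf q₀ Ls₀)
  = Ps , Coherent.onlyPaths coh , ↭-refl , trichotomy hmm wf coh
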